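{- Let $t\ge 0$, $k=t+1\le v$, and let $\mathcal{D}$ be a Steiner system $S(t,k,v)$ with point set $[v]$. Then for every $\alpha\in s(\mathcal{D})$ and every $n\in\mathbb{N}$, $$\tilde F_{\mathcal{D}}(n)[\alpha]=\tilde F_{\mathcal{D}}(\alpha-n)[\alpha].$$ In particular, $$F_{\mathcal{D}}(n)[\alpha]=F_{\mathcal{D}}\Big(2\binom{v}{k}-\alpha-n\Big)[\alpha].$$
   Context: $[v]=\{0,\dots,v-1\}$. A Steiner system $S(t,k,v)$ is a pair $([v],\mathcal{B})$ with $\mathcal{B}\subseteq\binom{[v]}{k}$ such that every $t$-subset of $[v]$ lies in exactly one block. Welter's game $\Gamma_{v,k}$ is the digraph on $\binom{[v]}{k}$ with edges $(P,P^{(p\,q)})$ for $q<p$, $p\in P$, $q\notin P$, where $P^{(p\,q)}=(P\setminus\{p\})\cup\{q\}$. Let $N^+(P)$ and $N^-(P)$ denote the out- and in-neighbor sets of $P$ in $\Gamma_{v,k}$. For a design $\mathcal{D}$ with block set $\mathcal{B}_{\mathcal{D}}$, define $$a_i(\mathcal{D})=\Big|\Big\{P\in\tbinom{[v]}{k}\setminus\mathcal{B}_{\mathcal{D}}:|N^+(P)\cap\mathcal{B}_{\mathcal{D}}|=i\Big\}\Big|,$$ $$\bar{\mathcal{P}}(\mathcal{D})=\mathcal{B}_{\mathcal{D}}\cup\bigcup_{B\in\mathcal{B}_{\mathcal{D}}}N^-(B),\qquad \tilde{\mathcal{P}}(\mathcal{D})=\tbinom{[v]}{k}\setminus\bar{\mathcal{P}}(\mathcal{D}).$$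 For $\pi\in\mathrm{Sym}([v])$, $\mathcal{D}^\pi=([v],\{B^\pi:B\in\mathcal{B}_{\mathcal{D}}\})$, and $O(\mathcal{D})=\{\mathcal{D}^\pi:\pi\in\mathrm{Sym}([v])\}$. Define $$s(\mathcal{D})=\{a_0(\mathcal{D}')+a_k(\mathcal{D}'):\mathcal{D}'\in O(\mathcal{D})\},\qquad O_\alpha(\mathcal{D})=\{\mathcal{D}'\in O(\mathcal{D}):a_0(\mathcal{D}')+a_k(\mathcal{D}')=\alpha\}.$$ For every integer $n$, set $$F_{\mathcal{D}}(n)[\alpha]=|\{\mathcal{D}'\in O_\alpha(\mathcal{D}):|\bar{\mathcal{P}}(\mathcal{D}')|=n\}|,\qquad \tilde F_{\mathcal{D}}(n)[\alpha]=|\{\mathcal{D}'\in O_\alpha(\mathcal{D}):|\tilde{\mathcal{P}}(\mathcal{D}')|=n\}|.$$ These values are $0$ when no design qualifies, e.g. for negative $n$. -}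

module Defs where

open import Data.Bool using (Bool; true; false; not; _∧_; _∨_; T)
open import Data.Nat using (ℕ; zero; suc; _+_; _*_; _≡ᵇ_; _<ᵇ_)
open import Data.Fin using (Fin; toℕ)
import Data.Fin.Properties as FinP
open import Data.Fin.Subset using (Subset; ∣_∣; inside; outside; _⊆_)
open import Data.Fin.Subset.Properties using (_⊆?_)
open import Data.Vec using (Vec; []; _∷_; lookup; tabulate; _[_]≔_)
import Data.Vec.Properties as VecP
import Data.Bool.Properties as BoolP
open import Data.List using (List; []; _∷_; length; filterᵇ; deduplicateᵇ; map; allFin; concatMap)
open import Data.Bool.ListAction using (all; any)
open import Data.Integer using (ℤ; +_; -[1+_])
open import Relation.Nullary.Decidable using (⌊_⌋)
open import Relation.Binary.PropositionalEquality using (_≡_)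

-- A design / block set on [v] is given by its characteristic function
-- 'Fam v' (which subsets are blocks).  Two families are the same design
-- iff they agree on every subset (decided by 'sameFam').

Fam : ℕ → Set
Fam v = Subset v → Bool

allVecs : {A : Set} → List A → (v : ℕ) → List (Vec A v)
allVecs xs zero    = [] ∷ []
allVecs xs (suc v) = concatMap (λ x → map (x ∷_) (allVecs xs v)) xs

allSubsets : (v : ℕ) → List (Subset v)
allSubsets v = allVecs (outside ∷ inside ∷ []) v

kSubsets : (v k : ℕ) → List (Subset v)
kSubsets v k = filterᵇ (λ P → ∣ P ∣ ≡ᵇ k) (allSubsets v)

eqSubᵇ : {v : ℕ} → Subset v → Subset v → Bool
eqSubᵇ P Q = ⌊ VecP.≡-dec BoolP._≟_ P Q ⌋

sameFam : {v : ℕ} → Fam v → Fam v → Bool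
sameFam {v} f g = all (λ P → ⌊ BoolP._≟_ (f P) (g P) ⌋) (allSubsets v)

blocks : {v : ℕ} → Fam v → List (Subset v)
blocks {v} f = filterᵇ f (allSubsets v)

record Steiner (t k v : ℕ) (f : Fam v) : Set where
  field
    blockSize : (B : Subset v) → T (f B) → ∣ B ∣ ≡ k
    unique    : (S : Subset v) → ∣ S ∣ ≡ t →
                length (filterᵇ (λ B → ⌊ S ⊆? B ⌋) (blocks f)) ≡ 1

-- Welter's game Γ_{v,k}: edge P → P^(p q) for q < p, p ∈ P, q ∉ P.

swapSub : {v : ℕ} → Subset v → Fin v → Fin v → Subset v
swapSub P p q = (P [ p ]≔ outside) [ q ]≔ inside

edgeᵇ : {v : ℕ} → Subset v → Subset v → Bool
edgeᵇ {v} P Q =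
  any (λ p → any (λ q →
         (toℕ q <ᵇ toℕ p) ∧ lookup P p ∧ not (lookup P q) ∧ eqSubᵇ Q (swapSub P p q))
       (allFin v)) (allFin v)

outBlocks : {v : ℕ} → (k : ℕ) → Fam v → Subset v → ℕ
outBlocks {v} k f P = length (filterᵇ (λ Q → edgeᵇ P Q ∧ f Q) (kSubsets v k))

aCoef : {v : ℕ} → (k : ℕ) → Fam v → ℕ → ℕ
aCoef {v} k f i =
  length (filterᵇ (λ P → not (f P) ∧ (outBlocks k f P ≡ᵇ i)) (kSubsets v k))

a0ak : {v : ℕ} → (k : ℕ) → Fam v → ℕ
a0ak k f = aCoef k f 0 + aCoef k f k

inPbarᵇ : {v : ℕ} → (k : ℕ) → Fam v → Subset v → Bool
inPbarᵇ {v} k f P = f P ∨ any (λ B → f B ∧ edgeᵇ P B) (kSubsets v k)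

Pbar : {v : ℕ} → (k : ℕ) → Fam v → ℕ
Pbar {v} k f = length (filterᵇ (inPbarᵇ k f) (kSubsets v k))

Ptilde : {v : ℕ} → (k : ℕ) → Fam v → ℕ
Ptilde {v} k f = length (filterᵇ (λ P → not (inPbarᵇ k f P)) (kSubsets v k))

-- Sym([v]): permutations of [v], given as their value vectors
-- (σ i = lookup s i), enumerated among all maps [v] → [v] and kept when
-- injective (equivalently bijective, [v] being finite).

injectiveᵇ : {v : ℕ} → Vec (Fin v) v → Bool
injectiveᵇ {v} s =
  all (λ i → all (λ j → not ⌊ FinP._≟_ (lookup s i) (lookup s j) ⌋ ∨ ⌊ FinP._≟_ i j ⌋)
                 (allFin v)) (allFin v)

perms : (v : ℕ) → List (Vec (Fin v) v)
perms v = filterᵇ injectiveᵇ (allVecs (allFin v) v)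

-- D^π : its blocks are B^π = π(B);  Q ∈ B_{D^π} iff π⁻¹(Q) ∈ B_D,
-- and π⁻¹(Q) has indicator i ↦ Q (π i).
act : {v : ℕ} → Fam v → Vec (Fin v) v → Fam v
act f s Q = f (tabulate (λ i → lookup Q (lookup s i)))

orbit : {v : ℕ} → Fam v → List (Fam v)
orbit {v} f = deduplicateᵇ sameFam (map (act f) (perms v))

sSet : {v : ℕ} → (k : ℕ) → Fam v → List ℕ
sSet k f = map (a0ak k) (orbit f)

F : {v : ℕ} → (k : ℕ) → Fam v → ℤ → ℕ → ℕ
F k f (+ n)     α = length (filterᵇ (λ g → (a0ak k g ≡ᵇ α) ∧ (Pbar k g ≡ᵇ n)) (orbit f))
F k f -[1+ n ]  α = 0

Ftilde : {v : ℕ} → (k : ℕ) → Fam v → ℤ → ℕ → ℕ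
Ftilde k f (+ n)     α = length (filterᵇ (λ g → (a0ak k g ≡ᵇ α) ∧ (Ptilde k g ≡ᵇ n)) (orbit f))
Ftilde k f -[1+ n ]  α = 0

module Submission where

-- Let ρ be the reversal i ↦ v-1-i of the points.  For a k-set P that
-- is not a block and a point p ∈ P, the t-set P ∖ {p} lies in a unique block
-- (P ∖ {p}) ∪ {q}, with q ∉ P.  Moving p to q is a move of Welter's game when
-- q < p, and it becomes one after reversing the points when q > p.  Hence
--     |N⁺(P) ∩ B_D| + |N⁺(ρP) ∩ B_{D^ρ}| = k          (outdegree-reversal),
-- so reversal exchanges a₀ and aₖ.  As O(D) is closed under reversal, this
-- makes the counts of designs in O(D) with (a₀, aₖ) = (x, y) and (y, x)
-- agree (Orbit.exchange).  Finally |P̃| = a₀ and |P̄| = C(v,k) - a₀, and with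
-- a₀ + aₖ = α exchanging a₀ and aₖ is exactly the claimed reflection.

open import Defs

open import Algebra.Properties.CommutativeSemigroup using (interchange)
open import Data.Bool using (Bool; true; false; not; _∧_; _∨_; T; T?)
open import Data.Bool.ListAction using (any; all)
open import Data.Bool.Properties using (T-∧; T-≡; T-not-≡; ∧-comm; ∧-zeroʳ) renaming (_≟_ to _≟B_)
open import Data.Empty using (⊥; ⊥-elim)
open import Data.Fin using (Fin; toℕ; punchOut; opposite) renaming (zero to fzero; suc to fsuc)
open import Data.Fin.Properties
  using (any?; punchOut-injective; injective⇒≤; opposite-involutive; opposite-prop; toℕ<n; toℕ-injective)
  renaming (_≟_ to _≟F_)
open import Data.Fin.Subset using (Subset; ∣_∣; inside; outside; _⊆_)
open import Data.Fin.Subset.Properties using (_⊆?_; drop-∷-⊆; p⊆q⇒∣p∣≤∣q∣)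
open import Data.Integer using (ℤ; +_; -[1+_]; _-_)
import Data.Integer as ℤ
open import Data.Integer.Properties using (i≡j⇒i-j≡0; i-j≡0⇒i≡j; neg-involutive; pos-+) renaming (_≟_ to _≟ℤ_)
open import Data.Integer.Tactic.RingSolver using (solve-∀)
open import Data.List using (List; []; _∷_; length; filterᵇ; map; _++_; allFin; deduplicateᵇ)
open import Data.List.Membership.Propositional using (_∈_; lose; find)
open import Data.List.Membership.Propositional.Properties
  using (∈-allFin; ∈-map⁺; ∈-map⁻; ∈-++⁻; ∈-concatMap⁺; ∈-filter⁺; ∈-filter⁻)
open import Data.List.Properties using (length-++; filter-++; map-tabulate; ++-identityʳ)
open import Data.List.Relation.Unary.Any using (Any; here; there)
import Data.List.Relation.Unary.Any as Any
open import Data.List.Relation.Unary.Any.Properties using (any⁺; any⁻)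
import Data.List.Relation.Unary.Any.Properties as AnyP
import Data.List.Relation.Unary.All as All
import Data.List.Relation.Unary.All.Properties as AllP
open import Data.List.Relation.Unary.AllPairs using (AllPairs; []; _∷_)
import Data.List.Relation.Unary.AllPairs.Properties as AllPairsP
open import Data.List.Relation.Unary.Unique.Propositional using (Unique)
import Data.List.Relation.Unary.Unique.Propositional.Properties as UniqueP
open import Data.Nat using (ℕ; zero; suc; _+_; _*_; _≤_; _<_; z≤n; s≤s; _≡ᵇ_; _<ᵇ_)
open import Data.Nat.Combinatorics using (_C_; nCk+nC[k+1]≡[n+1]C[k+1])
open import Data.Nat.Properties
  using (+-suc; +-comm; +-identityʳ; +-cancelˡ-≡; +-commutativeSemigroup; ≤-antisym; 1+n≰n; suc-injective;
         <-irrefl; <-cmp; ∸-monoʳ-<; ≡⇒≡ᵇ; ≡ᵇ⇒≡; <ᵇ⇒<; <⇒<ᵇ)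
open import Data.Product using (Σ; _×_; _,_; proj₁; proj₂)
open import Data.Sum using (_⊎_; inj₁; inj₂)
open import Data.Vec using (Vec; []; _∷_; lookup; tabulate; _[_]≔_)
import Data.Vec as Vec
open import Data.Vec.Properties
  using (lookup∘tabulate; tabulate∘lookup; tabulate-cong; []=⇒lookup; lookup⇒[]=; ∷-injectiveʳ;
         lookup∘update; lookup∘update′; []≔-idempotent; []≔-lookup)
open import Function using (_∘_)
open import Function.Bundles using (Equivalence)
open import Function.Definitions using (Injective)
open import Relation.Binary using (tri<; tri≈; tri>)
open import Relation.Binary.PropositionalEquality
  using (_≡_; _≢_; refl; sym; trans; cong; cong₂; subst; subst₂; module ≡-Reasoning)
open import Relation.Nullary using (¬_; ¬?; yes; no)
open import Relation.Nullary.Decidable using (⌊_⌋; toWitness; fromWitness)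

count : {A : Set} → (A → Bool) → List A → ℕ
count p xs = length (filterᵇ p xs)

⟦_⟧ : Bool → ℕ
⟦ true ⟧  = 1
⟦ false ⟧ = 0

module _ {A : Set} where

  count-cons : (p : A → Bool) (x : A) (xs : List A) → count p (x ∷ xs) ≡ ⟦ p x ⟧ + count p xs
  count-cons p x xs with p x
  ... | true  = refl
  ... | false = refl

  count-cong : (p q : A → Bool) (xs : List A) → (∀ x → x ∈ xs → p x ≡ q x) → count p xs ≡ count q xs
  count-cong p q []       h = refl
  count-cong p q (x ∷ xs) h = begin
    count p (x ∷ xs)         ≡⟨ count-cons p x xs ⟩
    ⟦ p x ⟧ + count p xs     ≡⟨ cong₂ _+_ (cong ⟦_⟧ (h x (here refl))) (count-cong p q xs (λ y m → h y (there m))) ⟩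
    ⟦ q x ⟧ + count q xs     ≡⟨ count-cons q x xs ⟨
    count q (x ∷ xs)         ∎
    where open ≡-Reasoning

  count-sum : (p q r : A → Bool) (xs : List A) → (∀ x → x ∈ xs → ⟦ p x ⟧ + ⟦ q x ⟧ ≡ ⟦ r x ⟧) →
              count p xs + count q xs ≡ count r xs
  count-sum p q r []       h = refl
  count-sum p q r (x ∷ xs) h = begin
    count p (x ∷ xs) + count q (x ∷ xs)              ≡⟨ cong₂ _+_ (count-cons p x xs) (count-cons q x xs) ⟩
    (⟦ p x ⟧ + count p xs) + (⟦ q x ⟧ + count q xs)  ≡⟨ interchange +-commutativeSemigroup ⟦ p x ⟧ _ ⟦ q x ⟧ _ ⟩
    (⟦ p x ⟧ + ⟦ q x ⟧) + (count p xs + count q xs)  ≡⟨ cong₂ _+_ (h x (here refl)) (count-sum p q r xs (λ y m → h y (there m))) ⟩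
    ⟦ r x ⟧ + count r xs                             ≡⟨ count-cons r x xs ⟨
    count r (x ∷ xs)                                 ∎
    where open ≡-Reasoning

  count-complement : (p : A → Bool) (xs : List A) → count p xs + count (λ x → not (p x)) xs ≡ length xs
  count-complement p []       = refl
  count-complement p (x ∷ xs) with p x
  ... | true  = cong suc (count-complement p xs)
  ... | false = trans (+-suc _ _) (cong suc (count-complement p xs))

  count-none : (p : A → Bool) (xs : List A) → (∀ x → x ∈ xs → p x ≡ false) → count p xs ≡ 0
  count-none p []       h = refl
  count-none p (x ∷ xs) h rewrite count-cons p x xs | h x (here refl) = count-none p xs (λ y m → h y (there m))

  count≡0 : (p : A → Bool) (xs : List A) → (count p xs ≡ᵇ 0) ≡ not (any p xs)
  count≡0 p []       = refl
  count≡0 p (x ∷ xs) with p x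
  ... | true  = refl
  ... | false = count≡0 p xs

  count-filter : (c p : A → Bool) (xs : List A) → count p (filterᵇ c xs) ≡ count (λ x → c x ∧ p x) xs
  count-filter c p []       = refl
  count-filter c p (x ∷ xs) rewrite count-cons (λ x → c x ∧ p x) x xs with c x
  ... | true  = trans (count-cons p x (filterᵇ c xs)) (cong (_+_ ⟦ p x ⟧) (count-filter c p xs))
  ... | false = count-filter c p xs

  count-++ : (p : A → Bool) (xs ys : List A) → count p (xs ++ ys) ≡ count p xs + count p ys
  count-++ p xs ys = trans (cong length (filter-++ (T? ∘ p) xs ys)) (length-++ (filterᵇ p xs))


count-map : {A B : Set} (p : B → Bool) (f : A → B) (xs : List A) → count p (map f xs) ≡ count (p ∘ f) xs
count-map p f []       = refl
count-map p f (x ∷ xs) rewrite count-cons p (f x) (map f xs) | count-cons (p ∘ f) x xs =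
  cong (_+_ ⟦ p (f x) ⟧) (count-map p f xs)

module _ {A B : Set} where

  private
    remove : {P : B → Set} (ys : List B) → Any P ys → List B
    remove (y ∷ ys) (here _)  = ys
    remove (y ∷ ys) (there a) = y ∷ remove ys a

    length-remove : {P : B → Set} (ys : List B) (a : Any P ys) → length ys ≡ suc (length (remove ys a))
    length-remove (y ∷ ys) (here _)  = refl
    length-remove (y ∷ ys) (there a) = cong suc (length-remove ys a)

    split : {P Q : B → Set} (ys : List B) (a : Any P ys) → Any Q ys →
            (Σ B λ y → P y × Q y) ⊎ Any Q (remove ys a)
    split (y ∷ ys) (here py) (here qy) = inj₁ (y , py , qy)
    split (y ∷ ys) (here py) (there b) = inj₂ b
    split (y ∷ ys) (there a) (here qy) = inj₂ (here qy)
    split (y ∷ ys) (there a) (there b) with split ys a b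
    ... | inj₁ r = inj₁ r
    ... | inj₂ r = inj₂ (there r)

  pigeonhole : (_≈_ : A → A → Set) (R : A → B → Set) (xs : List A) (ys : List B) →
               AllPairs (λ x x′ → ¬ x ≈ x′) xs →
               (∀ x → x ∈ xs → Any (R x) ys) →
               (∀ x x′ y → x ∈ xs → x′ ∈ xs → R x y → R x′ y → x ≈ x′) →
               length xs ≤ length ys
  pigeonhole _≈_ R []       ys distinct covered functional = z≤n
  pigeonhole _≈_ R (x ∷ xs) ys (x≉xs ∷ distinct) covered functional =
    subst (suc (length xs) ≤_) (sym (length-remove ys image))
      (s≤s (pigeonhole _≈_ R xs (remove ys image) distinct covered′
              (λ z z′ y m m′ → functional z z′ y (there m) (there m′))))
    where
    image : Any (R x) ys
    image = covered x (here refl)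
    covered′ : ∀ z → z ∈ xs → Any (R z) (remove ys image)
    covered′ z m with split ys image (covered z (there m))
    ... | inj₁ (y , rxy , rzy) = ⊥-elim (All.lookup x≉xs m (functional x z y (here refl) (there m) rxy rzy))
    ... | inj₂ r = r

count-bijection : {A : Set} (L : List A) → Unique L → (∀ x → x ∈ L) →
                  (σ : A → A) → (∀ {x y} → σ x ≡ σ y → x ≡ y) → (∀ y → Σ A λ x → σ x ≡ y) →
                  (p : A → Bool) → count (p ∘ σ) L ≡ count p L
count-bijection L unique complete σ injective surjective p = ≤-antisym forward backward
  where
  forward : count (p ∘ σ) L ≤ count p L
  forward = pigeonhole _≡_ (λ x y → σ x ≡ y) (filterᵇ (p ∘ σ) L) (filterᵇ p L)
    (UniqueP.filter⁺ (T? ∘ p ∘ σ) unique)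
    (λ x m → Any.map (λ { refl → refl })
               (∈-filter⁺ (T? ∘ p) (complete (σ x)) (proj₂ (∈-filter⁻ (T? ∘ p ∘ σ) {xs = L} m))))
    (λ x x′ y _ _ e e′ → injective (trans e (sym e′)))
  backward : count p L ≤ count (p ∘ σ) L
  backward = pigeonhole _≡_ (λ y x → σ x ≡ y) (filterᵇ p L) (filterᵇ (p ∘ σ) L)
    (UniqueP.filter⁺ (T? ∘ p) unique)
    (λ y m → let (x , σx≡y) = surjective y in
      Any.map (λ { refl → σx≡y })
        (∈-filter⁺ (T? ∘ p ∘ σ) (complete x) (subst (T ∘ p) (sym σx≡y) (proj₂ (∈-filter⁻ (T? ∘ p) {xs = L} m)))))
    (λ y y′ x _ _ e e′ → trans (sym e) e′)

-- An injective map [v] → [v] is onto: otherwise, punching out a missed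
-- value would give an injection [v] → [v-1].
injective⇒surjective : {v : ℕ} (f : Fin v → Fin v) → Injective _≡_ _≡_ f → ∀ y → Σ (Fin v) λ x → f x ≡ y
injective⇒surjective {suc v} f f-injective y with any? (λ x → f x ≟F y)
... | yes hit  = hit
... | no ¬hit = ⊥-elim (1+n≰n (injective⇒≤ {f = missing} missing-injective))
  where
  missing : Fin (suc v) → Fin v
  misses : ∀ x → y ≢ f x
  misses x y≡fx = ¬hit (x , sym y≡fx)
  missing x = punchOut (misses x)
  missing-injective : Injective _≡_ _≡_ missing
  missing-injective {x} {x′} e = f-injective (punchOut-injective (misses x) (misses x′) e)

vec-ext : {A : Set} {n : ℕ} {xs ys : Vec A n} → (∀ i → lookup xs i ≡ lookup ys i) → xs ≡ ys
vec-ext {xs = xs} {ys} h = trans (sym (tabulate∘lookup xs)) (trans (tabulate-cong h) (tabulate∘lookup ys))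

allVecs-complete : {A : Set} (xs : List A) → (∀ a → a ∈ xs) → ∀ {v} (w : Vec A v) → w ∈ allVecs xs v
allVecs-complete xs complete []      = here refl
allVecs-complete xs complete {suc v} (a ∷ w) =
  ∈-concatMap⁺ (λ x → map (x ∷_) (allVecs xs v)) (Any.map (λ { refl → ∈-map⁺ (a ∷_) (allVecs-complete xs complete w) }) (complete a))

allSubsets-complete : {v : ℕ} (P : Subset v) → P ∈ allSubsets v
allSubsets-complete = allVecs-complete (outside ∷ inside ∷ []) (λ { false → here refl ; true → there (here refl) })

allSubsets-unique : (v : ℕ) → Unique (allSubsets v)
allSubsets-unique zero    = All.[] ∷ []
allSubsets-unique (suc v) =
  UniqueP.++⁺ (UniqueP.map⁺ ∷-injectiveʳ previous)
              (UniqueP.++⁺ (UniqueP.map⁺ ∷-injectiveʳ previous) [] (λ ()))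
              disjoint
  where
  previous : Unique (allSubsets v)
  previous = allSubsets-unique v
  disjoint : ∀ {P} → P ∈ map (outside ∷_) (allSubsets v) × P ∈ map (inside ∷_) (allSubsets v) ++ [] → ⊥
  disjoint (m , m′) with ∈-map⁻ (outside ∷_) m | ∈-++⁻ (map (inside ∷_) (allSubsets v)) m′
  ... | _ , _ , refl | inj₁ m″ with ∈-map⁻ (inside ∷_) m″
  ...   | _ , _ , ()
  disjoint (m , m′) | _ | inj₂ ()

∈-kSubsets⁺ : {v : ℕ} (k : ℕ) (Q : Subset v) → ∣ Q ∣ ≡ k → Q ∈ kSubsets v k
∈-kSubsets⁺ k Q e = ∈-filter⁺ (T? ∘ (_≡ᵇ k) ∘ ∣_∣) (allSubsets-complete Q) (≡⇒≡ᵇ _ _ e)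

∈-kSubsets⁻ : {v : ℕ} (k : ℕ) (Q : Subset v) → Q ∈ kSubsets v k → ∣ Q ∣ ≡ k
∈-kSubsets⁻ {v} k Q m = ≡ᵇ⇒≡ _ _ (proj₂ (∈-filter⁻ (T? ∘ (_≡ᵇ k) ∘ ∣_∣) {xs = allSubsets v} m))

kSubsets-unique : (v k : ℕ) → Unique (kSubsets v k)
kSubsets-unique v k = UniqueP.filter⁺ _ (allSubsets-unique v)

-- |binom([v],k)| = v C k, by Pascal's rule on the first point.
number-of-kSubsets : ∀ v k → length (kSubsets v k) ≡ v C k
number-of-kSubsets zero    zero    = refl
number-of-kSubsets zero    (suc k) = refl
number-of-kSubsets (suc v) k = begin
  count (λ P → ∣ P ∣ ≡ᵇ k) (map (outside ∷_) A ++ (map (inside ∷_) A ++ []))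
    ≡⟨ count-++ (λ P → ∣ P ∣ ≡ᵇ k) (map (outside ∷_) A) _ ⟩
  count (λ P → ∣ P ∣ ≡ᵇ k) (map (outside ∷_) A) + count (λ P → ∣ P ∣ ≡ᵇ k) (map (inside ∷_) A ++ [])
    ≡⟨ cong₂ _+_ (count-map _ (outside ∷_) A)
                 (trans (cong (count _) (++-identityʳ (map (inside ∷_) A))) (count-map _ (inside ∷_) A)) ⟩
  count (λ P → ∣ P ∣ ≡ᵇ k) A + count (λ P → suc ∣ P ∣ ≡ᵇ k) A
    ≡⟨ pascal k ⟩
  suc v C k ∎
  where
  open ≡-Reasoning
  A : List (Subset v)
  A = allSubsets v
  pascal : ∀ k → count (λ P → ∣ P ∣ ≡ᵇ k) A + count (λ P → suc ∣ P ∣ ≡ᵇ k) A ≡ suc v C k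
  pascal zero    = cong₂ _+_ (number-of-kSubsets v zero) (count-none _ A (λ _ _ → refl))
  pascal (suc k) = trans (+-comm (count (λ P → ∣ P ∣ ≡ᵇ suc k) A) _)
                         (trans (cong₂ _+_ (number-of-kSubsets v k) (number-of-kSubsets v (suc k)))
                                (nCk+nC[k+1]≡[n+1]C[k+1] v k))

size-as-count : {v : ℕ} (P : Subset v) → ∣ P ∣ ≡ count (lookup P) (allFin v)
size-as-count []            = refl
size-as-count {suc v} (b ∷ P) = begin
  ∣ b ∷ P ∣                                           ≡⟨ head b ⟩
  ⟦ b ⟧ + count (lookup P) (allFin v)                 ≡⟨ cong (_+_ ⟦ b ⟧) (count-map (lookup (b ∷ P)) fsuc (allFin v)) ⟨
  ⟦ b ⟧ + count (lookup (b ∷ P)) (map fsuc (allFin v)) ≡⟨ count-cons (lookup (b ∷ P)) fzero _ ⟨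
  count (lookup (b ∷ P)) (fzero ∷ map fsuc (allFin v)) ≡⟨ cong (count (lookup (b ∷ P)) ∘ (fzero ∷_)) (map-tabulate (λ i → i) fsuc) ⟩
  count (lookup (b ∷ P)) (allFin (suc v))             ∎
  where
  open ≡-Reasoning
  head : ∀ b → ∣ b ∷ P ∣ ≡ ⟦ b ⟧ + count (lookup P) (allFin v)
  head true  = cong suc (size-as-count P)
  head false = size-as-count P

-- Relabelling points by a permutation

-- For a permutation π of [v] (given by its value vector s),
-- relabel s Q = π⁻¹(Q) = {i : π i ∈ Q}; thus  act f s Q = f (relabel s Q).
relabel : {v : ℕ} → Vec (Fin v) v → Subset v → Subset v
relabel s Q = tabulate (λ i → lookup Q (lookup s i))

lookup-relabel : {v : ℕ} (s : Vec (Fin v) v) (Q : Subset v) (i : Fin v) →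
                 lookup (relabel s Q) i ≡ lookup Q (lookup s i)
lookup-relabel s Q = lookup∘tabulate (λ i → lookup Q (lookup s i))

IsPermutation : {v : ℕ} → Vec (Fin v) v → Set
IsPermutation s = Injective _≡_ _≡_ (lookup s)

injectiveᵇ-sound : {v : ℕ} (s : Vec (Fin v) v) → T (injectiveᵇ s) → IsPermutation s
injectiveᵇ-sound {v} s h {x} {y} e = decide (All.lookup (AllP.all⁺ (distinctFrom x) (allFin v) (All.lookup (AllP.all⁺ (λ x → all (distinctFrom x) (allFin v)) (allFin v) h) (∈-allFin x))) (∈-allFin y))
  where
  distinctFrom : Fin v → Fin v → Bool
  distinctFrom x y = not ⌊ lookup s x ≟F lookup s y ⌋ ∨ ⌊ x ≟F y ⌋
  decide : T (not ⌊ lookup s x ≟F lookup s y ⌋ ∨ ⌊ x ≟F y ⌋) → x ≡ y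
  decide d with lookup s x ≟F lookup s y | x ≟F y
  ... | _      | yes x≡y = x≡y
  ... | no s≢s | no _    = ⊥-elim (s≢s e)

injectiveᵇ-complete : {v : ℕ} (s : Vec (Fin v) v) → IsPermutation s → T (injectiveᵇ s)
injectiveᵇ-complete {v} s perm =
  AllP.all⁻ (λ x → all (λ y → not ⌊ lookup s x ≟F lookup s y ⌋ ∨ ⌊ x ≟F y ⌋) (allFin v)) {xs = allFin v}
    (All.tabulate λ {x} _ → AllP.all⁻ (λ y → not ⌊ lookup s x ≟F lookup s y ⌋ ∨ ⌊ x ≟F y ⌋) {xs = allFin v} (All.tabulate λ {y} _ → decide x y))
  where
  decide : ∀ x y → T (not ⌊ lookup s x ≟F lookup s y ⌋ ∨ ⌊ x ≟F y ⌋)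
  decide x y with lookup s x ≟F lookup s y | x ≟F y
  ... | no _  | _       = _
  ... | yes _ | yes _   = _
  ... | yes e | no x≢y  = ⊥-elim (x≢y (perm e))

⊆⇒lookup : {v : ℕ} {S B : Subset v} → S ⊆ B → ∀ i → lookup S i ≡ true → lookup B i ≡ true
⊆⇒lookup {S = S} h i e = []=⇒lookup (h (lookup⇒[]= i S e))

lookup⇒⊆ : {v : ℕ} {S B : Subset v} → (∀ i → lookup S i ≡ true → lookup B i ≡ true) → S ⊆ B
lookup⇒⊆ {B = B} h {i} m = lookup⇒[]= i B (h i ([]=⇒lookup m))

size-relabel : {v : ℕ} (s : Vec (Fin v) v) → IsPermutation s → (Q : Subset v) → ∣ relabel s Q ∣ ≡ ∣ Q ∣
size-relabel {v} s perm Q = begin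
  ∣ relabel s Q ∣                          ≡⟨ size-as-count (relabel s Q) ⟩
  count (lookup (relabel s Q)) (allFin v)  ≡⟨ count-cong _ _ (allFin v) (λ i _ → lookup-relabel s Q i) ⟩
  count (lookup Q ∘ lookup s) (allFin v)   ≡⟨ count-bijection (allFin v) (UniqueP.allFin⁺ v) ∈-allFin
                                                (lookup s) perm (injective⇒surjective (lookup s) perm) (lookup Q) ⟩
  count (lookup Q) (allFin v)              ≡⟨ size-as-count Q ⟨
  ∣ Q ∣                                    ∎
  where open ≡-Reasoning

module Relabelling {v : ℕ} (s : Vec (Fin v) v) (perm : IsPermutation s) where

  private
    preimage : Fin v → Fin v
    preimage y = proj₁ (injective⇒surjective (lookup s) perm y)

    s∘preimage : ∀ y → lookup s (preimage y) ≡ y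
    s∘preimage y = proj₂ (injective⇒surjective (lookup s) perm y)

    preimage∘s : ∀ x → preimage (lookup s x) ≡ x
    preimage∘s x = perm (s∘preimage (lookup s x))

  inverse : Vec (Fin v) v
  inverse = tabulate preimage

  relabel-inverse : ∀ Q → relabel s (relabel inverse Q) ≡ Q
  relabel-inverse Q = vec-ext λ i → begin
    lookup (relabel s (relabel inverse Q)) i     ≡⟨ lookup-relabel s (relabel inverse Q) i ⟩
    lookup (relabel inverse Q) (lookup s i)      ≡⟨ lookup-relabel inverse Q (lookup s i) ⟩
    lookup Q (lookup inverse (lookup s i))       ≡⟨ cong (lookup Q) (lookup∘tabulate preimage (lookup s i)) ⟩
    lookup Q (preimage (lookup s i))             ≡⟨ cong (lookup Q) (preimage∘s i) ⟩
    lookup Q i                                   ∎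
    where open ≡-Reasoning

  relabel-injective : ∀ {P Q} → relabel s P ≡ relabel s Q → P ≡ Q
  relabel-injective {P} {Q} e = vec-ext λ i → begin
    lookup P i                        ≡⟨ cong (lookup P) (s∘preimage i) ⟨
    lookup P (lookup s (preimage i))  ≡⟨ lookup-relabel s P (preimage i) ⟨
    lookup (relabel s P) (preimage i) ≡⟨ cong (λ X → lookup X (preimage i)) e ⟩
    lookup (relabel s Q) (preimage i) ≡⟨ lookup-relabel s Q (preimage i) ⟩
    lookup Q (lookup s (preimage i))  ≡⟨ cong (lookup Q) (s∘preimage i) ⟩
    lookup Q i                        ∎
    where open ≡-Reasoning

  relabel-⊆ : ∀ {S B} → S ⊆ B → relabel s S ⊆ relabel s B
  relabel-⊆ {S} {B} h = lookup⇒⊆ λ i e →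
    trans (lookup-relabel s B i) (⊆⇒lookup h (lookup s i) (trans (sym (lookup-relabel s S i)) e))

  relabel-⊆⁻ : ∀ {S B} → relabel s S ⊆ relabel s B → S ⊆ B
  relabel-⊆⁻ {S} {B} h = lookup⇒⊆ λ i e →
    let e′ = trans (lookup-relabel s S (preimage i)) (trans (cong (lookup S) (s∘preimage i)) e)
    in trans (cong (lookup B) (sym (s∘preimage i))) (trans (sym (lookup-relabel s B (preimage i))) (⊆⇒lookup h (preimage i) e′))

count-kSubsets-relabel : {v : ℕ} (k : ℕ) (s : Vec (Fin v) v) → IsPermutation s → (h : Subset v → Bool) →
                         count (h ∘ relabel s) (kSubsets v k) ≡ count h (kSubsets v k)
count-kSubsets-relabel {v} k s perm h = begin
  count (h ∘ relabel s) (kSubsets v k)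
    ≡⟨ count-filter size≡k (h ∘ relabel s) (allSubsets v) ⟩
  count (λ Q → size≡k Q ∧ h (relabel s Q)) (allSubsets v)
    ≡⟨ count-cong _ _ (allSubsets v) (λ Q _ → cong (λ n → (n ≡ᵇ k) ∧ h (relabel s Q)) (sym (size-relabel s perm Q))) ⟩
  count ((λ Q → size≡k Q ∧ h Q) ∘ relabel s) (allSubsets v)
    ≡⟨ count-bijection (allSubsets v) (allSubsets-unique v) allSubsets-complete (relabel s) relabel-injective
                       (λ Q → relabel inverse Q , relabel-inverse Q) (λ Q → size≡k Q ∧ h Q) ⟩
  count (λ Q → size≡k Q ∧ h Q) (allSubsets v)
    ≡⟨ count-filter size≡k h (allSubsets v) ⟨
  count h (kSubsets v k) ∎
  where
  open ≡-Reasoning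
  open Relabelling s perm
  size≡k : Subset v → Bool
  size≡k Q = ∣ Q ∣ ≡ᵇ k

record SteinerBlocks (t : ℕ) {v : ℕ} (g : Fam v) : Set where
  field
    blockSize : ∀ B → T (g B) → ∣ B ∣ ≡ suc t
    cover     : ∀ S → ∣ S ∣ ≡ t → Σ (Subset v) λ B → T (g B) × S ⊆ B
    unique    : ∀ {S B₁ B₂} → ∣ S ∣ ≡ t → T (g B₁) → T (g B₂) → S ⊆ B₁ → S ⊆ B₂ → B₁ ≡ B₂

steiner⇒blocks : ∀ {t v} (f : Fam v) → Steiner t (suc t) v f → SteinerBlocks t f
steiner⇒blocks {t} {v} f st = record { blockSize = Steiner.blockSize st ; cover = cover ; unique = unique }
  where
  blocksThrough : Subset v → List (Subset v)
  blocksThrough S = filterᵇ (λ B → ⌊ S ⊆? B ⌋) (blocks f)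

  singleton : ∀ S → ∣ S ∣ ≡ t → Σ (Subset v) λ B → blocksThrough S ≡ B ∷ []
  singleton S e with blocksThrough S | Steiner.unique st S e
  ... | B ∷ [] | _ = B , refl

  through⁺ : ∀ {S B} → T (f B) → S ⊆ B → B ∈ blocksThrough S
  through⁺ {S} {B} fB h = ∈-filter⁺ (T? ∘ (λ B → ⌊ S ⊆? B ⌋)) (∈-filter⁺ (T? ∘ f) (allSubsets-complete B) fB)
                                    (fromWitness (λ {x} → h {x}))

  cover : ∀ S → ∣ S ∣ ≡ t → Σ (Subset v) λ B → T (f B) × S ⊆ B
  cover S e with singleton S e
  ... | B , eq =
    let (inBlocks , S⊆B) = ∈-filter⁻ (T? ∘ (λ B → ⌊ S ⊆? B ⌋)) {xs = blocks f} (subst (B ∈_) (sym eq) (here refl))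
    in B , proj₂ (∈-filter⁻ (T? ∘ f) {xs = allSubsets v} inBlocks) , toWitness S⊆B

  unique : ∀ {S B₁ B₂} → ∣ S ∣ ≡ t → T (f B₁) → T (f B₂) → S ⊆ B₁ → S ⊆ B₂ → B₁ ≡ B₂
  unique {S} e f₁ f₂ h₁ h₂ with singleton S e
  ... | B , eq with subst (_ ∈_) eq (through⁺ f₁ h₁) | subst (_ ∈_) eq (through⁺ f₂ h₂)
  ...   | here refl | here refl = refl

relabel-blocks : ∀ {t v} (g : Fam v) (s : Vec (Fin v) v) → IsPermutation s →
                 SteinerBlocks t g → SteinerBlocks t (act g s)
relabel-blocks {t} {v} g s perm G = record { blockSize = blockSize′ ; cover = cover′ ; unique = unique′ }
  where
  open SteinerBlocks G
  open Relabelling s perm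
  blockSize′ : ∀ B → T (g (relabel s B)) → ∣ B ∣ ≡ suc t
  blockSize′ B h = trans (sym (size-relabel s perm B)) (blockSize (relabel s B) h)
  cover′ : ∀ S → ∣ S ∣ ≡ t → Σ (Subset v) λ B → T (g (relabel s B)) × S ⊆ B
  cover′ S e with cover (relabel s S) (trans (size-relabel s perm S) e)
  ... | B , gB , h = relabel inverse B , subst (T ∘ g) (sym (relabel-inverse B)) gB ,
                     relabel-⊆⁻ (subst (relabel s S ⊆_) (sym (relabel-inverse B)) h)
  unique′ : ∀ {S B₁ B₂} → ∣ S ∣ ≡ t → T (g (relabel s B₁)) → T (g (relabel s B₂)) → S ⊆ B₁ → S ⊆ B₂ → B₁ ≡ B₂
  unique′ {S} e g₁ g₂ h₁ h₂ = relabel-injective (unique (trans (size-relabel s perm S) e) g₁ g₂ (relabel-⊆ h₁) (relabel-⊆ h₂))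

T-ext : ∀ {a b} → (T a → T b) → (T b → T a) → a ≡ b
T-ext {false} {false} _ _ = refl
T-ext {false} {true}  _ g = ⊥-elim (g _)
T-ext {true}  {false} f _ = ⊥-elim (f _)
T-ext {true}  {true}  _ _ = refl

split∧ : ∀ {a b} → T (a ∧ b) → T a × T b
split∧ = Equivalence.to T-∧

join∧ : ∀ {a b} → T a → T b → T (a ∧ b)
join∧ x y = Equivalence.from T-∧ (x , y)

true≢false : true ≢ false
true≢false ()

<ᵇ-holds : ∀ {m n} → m < n → (m <ᵇ n) ≡ true
<ᵇ-holds = Equivalence.to T-≡ ∘ <⇒<ᵇ

<ᵇ-fails : ∀ {m n} → ¬ m < n → (m <ᵇ n) ≡ false
<ᵇ-fails {m} {n} m≮n with m <ᵇ n in e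
... | false = refl
... | true  = ⊥-elim (m≮n (<ᵇ⇒< m n (subst T (sym e) _)))

delete : {v : ℕ} → Subset v → Fin v → Subset v
delete P p = P [ p ]≔ outside

module _ {v : ℕ} (P : Subset v) (p q : Fin v) where

  swap-at-out : q ≢ p → lookup (swapSub P p q) p ≡ false
  swap-at-out q≢p = trans (lookup∘update′ (q≢p ∘ sym) (delete P p) inside) (lookup∘update p P outside)

  swap-at-in : lookup (swapSub P p q) q ≡ true
  swap-at-in = lookup∘update q (delete P p) inside

  swap-elsewhere : ∀ j → j ≢ p → j ≢ q → lookup (swapSub P p q) j ≡ lookup P j
  swap-elsewhere j j≢p j≢q = trans (lookup∘update′ j≢q (delete P p) inside) (lookup∘update′ j≢p P outside)

  delete⊆swap : delete P p ⊆ swapSub P p q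
  delete⊆swap = lookup⇒⊆ inserted
    where
    inserted : ∀ i → lookup (delete P p) i ≡ true → lookup (swapSub P p q) i ≡ true
    inserted i e with q ≟F i
    ... | yes refl = swap-at-in
    ... | no q≢i   = trans (lookup∘update′ (q≢i ∘ sym) (delete P p) inside) e

size-delete : {v : ℕ} (P : Subset v) (p : Fin v) → lookup P p ≡ true → ∣ P ∣ ≡ suc ∣ delete P p ∣
size-delete (true ∷ P)  fzero    refl = refl
size-delete (true ∷ P)  (fsuc p) e    = cong suc (size-delete P p e)
size-delete (false ∷ P) (fsuc p) e    = size-delete P p e

⊆-same-size : {v : ℕ} (S B : Subset v) → S ⊆ B → ∣ B ∣ ≡ ∣ S ∣ → B ≡ S
⊆-same-size []            []            h e = refl
⊆-same-size (true ∷ S)    (true ∷ B)    h e = cong (true ∷_) (⊆-same-size S B (drop-∷-⊆ h) (suc-injective e))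
⊆-same-size (true ∷ S)    (false ∷ B)   h e with h Vec.here
... | ()
⊆-same-size (false ∷ S)   (true ∷ B)    h e = ⊥-elim (<-irrefl (sym e) (s≤s (p⊆q⇒∣p∣≤∣q∣ (drop-∷-⊆ h))))
⊆-same-size (false ∷ S)   (false ∷ B)   h e = cong (false ∷_) (⊆-same-size S B (drop-∷-⊆ h) e)

one-point-extension : {v : ℕ} (S B : Subset v) → S ⊆ B → ∣ B ∣ ≡ suc ∣ S ∣ →
                      Σ (Fin v) λ q → lookup S q ≡ false × B ≡ S [ q ]≔ inside
one-point-extension (true ∷ S)  (true ∷ B)  h e with one-point-extension S B (drop-∷-⊆ h) (suc-injective e)
... | q , q∉S , B≡ = fsuc q , q∉S , cong (true ∷_) B≡
one-point-extension (true ∷ S)  (false ∷ B) h e with h Vec.here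
... | ()
one-point-extension (false ∷ S) (true ∷ B)  h e = fzero , refl , cong (true ∷_) (⊆-same-size S B (drop-∷-⊆ h) (suc-injective e))
one-point-extension (false ∷ S) (false ∷ B) h e with one-point-extension S B (drop-∷-⊆ h) e
... | q , q∉S , B≡ = fsuc q , q∉S , cong (false ∷_) B≡

-- Welter's game for an arbitrary order of the points

module _ {v : ℕ} where

  -- The game in which p ∈ P may be exchanged for q ∉ P whenever  before q p;
  -- Welter's game itself is  edgeᵇ = edgeWith (λ q p → toℕ q <ᵇ toℕ p).
  edgeWith : (Fin v → Fin v → Bool) → Subset v → Subset v → Bool
  edgeWith before P Q =
    any (λ p → any (λ q → before q p ∧ lookup P p ∧ not (lookup P q) ∧ eqSubᵇ Q (swapSub P p q)) (allFin v)) (allFin v)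

  MoveAt : (Fin v → Fin v → Bool) → Subset v → Subset v → Fin v → Set
  MoveAt before P Q p = Σ (Fin v) λ q → T (before q p) × lookup P p ≡ true × lookup P q ≡ false × Q ≡ swapSub P p q

  edgeWith-sound : ∀ before P Q → T (edgeWith before P Q) → Σ (Fin v) (MoveAt before P Q)
  edgeWith-sound before P Q h with Any.satisfied (any⁻ _ (allFin v) h)
  ... | p , h′ with Any.satisfied (any⁻ _ (allFin v) h′)
  ... | q , h″ with split∧ h″
  ... | q-before-p , h‴ with split∧ h‴
  ... | p∈P , h⁗ with split∧ h⁗
  ... | q∉P , Q≡ = p , q , q-before-p , Equivalence.to T-≡ p∈P , Equivalence.to T-not-≡ q∉P , toWitness Q≡

  edgeWith-complete : ∀ before P Q p → MoveAt before P Q p → T (edgeWith before P Q)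
  edgeWith-complete before P Q p (q , q-before-p , p∈P , q∉P , Q≡) =
    any⁺ _ (lose (∈-allFin p) (any⁺ _ (lose (∈-allFin q)
      (join∧ q-before-p (join∧ (Equivalence.from T-≡ p∈P) (join∧ (Equivalence.from T-not-≡ q∉P) (fromWitness Q≡)))))))

  movable : (Fin v → Fin v → Bool) → Fam v → Subset v → Fin v → Bool
  movable before g P p = any (λ q → before q p ∧ not (lookup P q) ∧ g (swapSub P p q)) (allFin v)

  blockMoveAt : (Fin v → Fin v → Bool) → Fam v → Subset v → Fin v → Bool
  blockMoveAt before g P p = lookup P p ∧ movable before g P p

  movable-sound : ∀ before g P p → T (movable before g P p) →
                  Σ (Fin v) λ q → T (before q p) × lookup P q ≡ false × T (g (swapSub P p q))
  movable-sound before g P p h with Any.satisfied (any⁻ _ (allFin v) h)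
  ... | q , h′ with split∧ h′
  ... | q-before-p , h″ with split∧ h″
  ... | q∉P , gQ = q , q-before-p , Equivalence.to T-not-≡ q∉P , gQ

  movable-complete : ∀ before g P p q → T (before q p) → lookup P q ≡ false → T (g (swapSub P p q)) →
                     T (movable before g P p)
  movable-complete before g P p q q-before-p q∉P gQ =
    any⁺ _ (lose (∈-allFin q) (join∧ q-before-p (join∧ (Equivalence.from T-not-≡ q∉P) gQ)))

  Complementary : (Fin v → Fin v → Bool) → (Fin v → Fin v → Bool) → Set
  Complementary before₁ before₂ = ∀ q p → q ≢ p → ⟦ before₁ q p ⟧ + ⟦ before₂ q p ⟧ ≡ 1

-- Out-degrees towards the blocks of a Steiner system S(t, t+1, v)

module OutDegree {t v : ℕ} {g : Fam v} (G : SteinerBlocks t g) (P : Subset v) (|P|≡k : ∣ P ∣ ≡ suc t) where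
  open SteinerBlocks G

  private
    K : List (Subset v)
    K = kSubsets v (suc t)

    size-delete′ : ∀ p → lookup P p ≡ true → ∣ delete P p ∣ ≡ t
    size-delete′ p p∈P = suc-injective (trans (sym (size-delete P p p∈P)) |P|≡k)

  blockEdge : (Fin v → Fin v → Bool) → Subset v → Bool
  blockEdge before Q = edgeWith before P Q ∧ g Q

  private
    edgeIsBlock : ∀ {before Q} → Q ∈ filterᵇ (blockEdge before) K → T (g Q)
    edgeIsBlock {before} {Q} m = proj₂ (split∧ {edgeWith before P Q} (proj₂ (∈-filter⁻ (T? ∘ blockEdge before) {xs = K} m)))

  -- Each block out-neighbour is reached by moving some point p, and two blocks
  -- reached by moving p coincide, as both contain the t-set P ∖ {p}.
  blockEdges≤movablePoints : ∀ before → count (blockEdge before) K ≤ count (blockMoveAt before g P) (allFin v)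
  blockEdges≤movablePoints before =
    pigeonhole _≡_ (MoveAt before P) (filterᵇ (blockEdge before) K) (filterᵇ (blockMoveAt before g P) (allFin v))
      (UniqueP.filter⁺ _ (kSubsets-unique v (suc t))) covered functional
    where
    covered : ∀ Q → Q ∈ filterᵇ (blockEdge before) K → Any (MoveAt before P Q) (filterᵇ (blockMoveAt before g P) (allFin v))
    covered Q m with edgeWith-sound before P Q (proj₁ (split∧ (proj₂ (∈-filter⁻ (T? ∘ blockEdge before) {xs = K} m))))
    ... | p , move@(q , q-before-p , p∈P , q∉P , Q≡) =
      lose (∈-filter⁺ (T? ∘ blockMoveAt before g P) (∈-allFin p)
             (join∧ (Equivalence.from T-≡ p∈P) (movable-complete before g P p q q-before-p q∉P (subst (T ∘ g) Q≡ (edgeIsBlock {before} m)))))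
           move
    functional : ∀ Q Q′ p → Q ∈ _ → Q′ ∈ _ → MoveAt before P Q p → MoveAt before P Q′ p → Q ≡ Q′
    functional Q Q′ p m m′ (q , _ , p∈P , _ , Q≡) (q′ , _ , _ , _ , Q′≡) =
      unique (size-delete′ p p∈P) (edgeIsBlock {before} m) (edgeIsBlock {before} m′)
             (subst (delete P p ⊆_) (sym Q≡) (delete⊆swap P p q)) (subst (delete P p ⊆_) (sym Q′≡) (delete⊆swap P p q′))

  -- Conversely each movable point yields a block out-neighbour, and the moved
  -- point is recovered as the one point of P missing from that neighbour.
  movablePoints≤blockEdges : ∀ before → count (blockMoveAt before g P) (allFin v) ≤ count (blockEdge before) K
  movablePoints≤blockEdges before =
    pigeonhole _≡_ (λ p Q → MoveAt before P Q p) (filterᵇ (blockMoveAt before g P) (allFin v)) (filterᵇ (blockEdge before) K)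
      (UniqueP.filter⁺ _ (UniqueP.allFin⁺ v)) covered functional
    where
    covered : ∀ p → p ∈ filterᵇ (blockMoveAt before g P) (allFin v) → Any (λ Q → MoveAt before P Q p) (filterᵇ (blockEdge before) K)
    covered p m with split∧ (proj₂ (∈-filter⁻ (T? ∘ blockMoveAt before g P) {xs = allFin v} m))
    ... | p∈P , p-movable with movable-sound before g P p p-movable
    ... | q , q-before-p , q∉P , gQ =
      lose (∈-filter⁺ (T? ∘ blockEdge before) (∈-kSubsets⁺ (suc t) (swapSub P p q) (blockSize _ gQ))
             (join∧ (edgeWith-complete before P (swapSub P p q) p move) gQ))
           move
      where
      move : MoveAt before P (swapSub P p q) p
      move = q , q-before-p , Equivalence.to T-≡ p∈P , q∉P , refl
    functional : ∀ p p′ Q → p ∈ _ → p′ ∈ _ → MoveAt before P Q p → MoveAt before P Q p′ → p ≡ p′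
    functional p p′ Q _ _ (q , _ , p∈P , q∉P , Q≡) (q′ , _ , _ , q′∉P , Q≡′) with p ≟F p′
    ... | yes p≡p′ = p≡p′
    ... | no p≢p′ = ⊥-elim (true≢false (trans (sym p∈Q) p∉Q))
      where
      p∉Q : lookup Q p ≡ false
      p∉Q = trans (cong (λ X → lookup X p) Q≡) (swap-at-out P p q (λ { refl → true≢false (trans (sym p∈P) q∉P) }))
      p∈Q : lookup Q p ≡ true
      p∈Q = trans (cong (λ X → lookup X p) Q≡′)
                  (trans (swap-elsewhere P p′ q′ p p≢p′ (λ { refl → true≢false (trans (sym p∈P) q′∉P) })) p∈P)

  outdegree-by-points : (before : Fin v → Fin v → Bool) →
    count (blockEdge before) K ≡ count (blockMoveAt before g P) (allFin v)
  outdegree-by-points before = ≤-antisym (blockEdges≤movablePoints before) (movablePoints≤blockEdges before)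

  -- When P is not a block, every p ∈ P has exactly one partner q: the unique
  -- block through the t-set P ∖ {p} is (P ∖ {p}) ∪ {q}, and q ∉ P.
  record Partner (p : Fin v) : Set where
    field
      point   : Fin v
      point≢p : point ≢ p
      point∉P : lookup P point ≡ false
      isBlock : T (g (swapSub P p point))
      only    : ∀ q → lookup P q ≡ false → T (g (swapSub P p q)) → q ≡ point

  partner : g P ≡ false → ∀ p → lookup P p ≡ true → Partner p
  partner P∉g p p∈P with cover (delete P p) (size-delete′ p p∈P)
  ... | B , gB , P∖p⊆B with one-point-extension (delete P p) B P∖p⊆B (trans (blockSize B gB) (cong suc (sym (size-delete′ p p∈P))))
  ... | q , q∉P∖p , B≡ = record { point = q ; point≢p = q≢p ; point∉P = q∉P ; isBlock = subst (T ∘ g) B≡ gB ; only = only }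
    where
    q≢p : q ≢ p
    q≢p refl = true≢false (trans (sym (Equivalence.to T-≡ (subst (T ∘ g) B≡P gB))) P∉g)
      where
      B≡P : B ≡ P
      B≡P = trans B≡ (trans ([]≔-idempotent P p) (trans (cong (P [ p ]≔_) (sym p∈P)) ([]≔-lookup P p)))
    q∉P : lookup P q ≡ false
    q∉P = trans (sym (lookup∘update′ q≢p P outside)) q∉P∖p
    only : ∀ q′ → lookup P q′ ≡ false → T (g (swapSub P p q′)) → q′ ≡ q
    only q′ q′∉P gB′ with q′ ≟F q
    ... | yes q′≡q = q′≡q
    ... | no q′≢q = ⊥-elim (true≢false (trans (sym q′∈B) q′∉B))
      where
      same : swapSub P p q′ ≡ swapSub P p q
      same = unique (size-delete′ p p∈P) gB′ (subst (T ∘ g) B≡ gB) (delete⊆swap P p q′) (delete⊆swap P p q)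
      q′∈B : lookup (swapSub P p q) q′ ≡ true
      q′∈B = trans (cong (λ X → lookup X q′) (sym same)) (swap-at-in P p q′)
      q′∉B : lookup (swapSub P p q) q′ ≡ false
      q′∉B = trans (swap-elsewhere P p q q′ (λ { refl → true≢false (trans (sym p∈P) q′∉P) }) q′≢q) q′∉P

  movable-partner : ∀ before p → (r : Partner p) → movable before g P p ≡ before (Partner.point r) p
  movable-partner before p r = T-ext to from
    where
    open Partner r
    to : T (movable before g P p) → T (before point p)
    to h with movable-sound before g P p h
    ... | q , q-before-p , q∉P , gQ = subst (λ x → T (before x p)) (only q q∉P gQ) q-before-p
    from : T (before point p) → T (movable before g P p)
    from point-before-p = movable-complete before g P p point point-before-p point∉P isBlock

  -- For a non-block P, every point of P can be moved onto a block in exactly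
  -- one of two complementary games, so the two block out-degrees add up to |P|.
  outdegree-complementary : g P ≡ false → ∀ before₁ before₂ → Complementary before₁ before₂ →
    count (λ Q → edgeWith before₁ P Q ∧ g Q) K + count (λ Q → edgeWith before₂ P Q ∧ g Q) K ≡ suc t
  outdegree-complementary P∉g before₁ before₂ complementary = begin
    count (λ Q → edgeWith before₁ P Q ∧ g Q) K + count (λ Q → edgeWith before₂ P Q ∧ g Q) K
      ≡⟨ cong₂ _+_ (outdegree-by-points before₁) (outdegree-by-points before₂) ⟩
    count (blockMoveAt before₁ g P) (allFin v) + count (blockMoveAt before₂ g P) (allFin v)
      ≡⟨ count-sum _ _ _ (allFin v) (λ p _ → each-point p) ⟩
    count (lookup P) (allFin v)
      ≡⟨ size-as-count P ⟨
    ∣ P ∣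
      ≡⟨ |P|≡k ⟩
    suc t ∎
    where
    open ≡-Reasoning
    each-point : ∀ p → ⟦ blockMoveAt before₁ g P p ⟧ + ⟦ blockMoveAt before₂ g P p ⟧ ≡ ⟦ lookup P p ⟧
    each-point p with lookup P p in p∈P
    ... | false = refl
    ... | true  = let r = partner P∉g p p∈P in
      trans (cong₂ _+_ (cong ⟦_⟧ (movable-partner before₁ p r)) (cong ⟦_⟧ (movable-partner before₂ p r)))
            (complementary (Partner.point r) p (Partner.point≢p r))

-- Reversing the order of the points

module Reversal (v : ℕ) where

  ρ : Vec (Fin v) v
  ρ = tabulate opposite

  ρ-permutation : IsPermutation ρ
  ρ-permutation {x} {y} e = begin
    x                       ≡⟨ opposite-involutive x ⟨
    opposite (opposite x)   ≡⟨ cong opposite (trans (sym (lookup∘tabulate opposite x)) (trans e (lookup∘tabulate opposite y))) ⟩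
    opposite (opposite y)   ≡⟨ opposite-involutive y ⟩
    y                       ∎
    where open ≡-Reasoning

  rev : Subset v → Subset v
  rev = relabel ρ

  lookup-rev : ∀ Q i → lookup (rev Q) i ≡ lookup Q (opposite i)
  lookup-rev Q i = trans (lookup-relabel ρ Q i) (cong (lookup Q) (lookup∘tabulate opposite i))

  rev-involutive : ∀ Q → rev (rev Q) ≡ Q
  rev-involutive Q = vec-ext λ i →
    trans (lookup-rev (rev Q) i) (trans (lookup-rev Q (opposite i)) (cong (lookup Q) (opposite-involutive i)))

  rev-injective : ∀ {P Q} → rev P ≡ rev Q → P ≡ Q
  rev-injective {P} {Q} e = trans (sym (rev-involutive P)) (trans (cong rev e) (rev-involutive Q))

  rev-update : ∀ X a x → rev (X [ a ]≔ x) ≡ rev X [ opposite a ]≔ x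
  rev-update X a x = vec-ext pointwise
    where
    pointwise : ∀ i → lookup (rev (X [ a ]≔ x)) i ≡ lookup (rev X [ opposite a ]≔ x) i
    pointwise i with i ≟F opposite a
    ... | yes refl = begin
      lookup (rev (X [ a ]≔ x)) (opposite a)   ≡⟨ lookup-rev (X [ a ]≔ x) (opposite a) ⟩
      lookup (X [ a ]≔ x) (opposite (opposite a)) ≡⟨ cong (lookup (X [ a ]≔ x)) (opposite-involutive a) ⟩
      lookup (X [ a ]≔ x) a                    ≡⟨ lookup∘update a X x ⟩
      x                                        ≡⟨ lookup∘update (opposite a) (rev X) x ⟨
      lookup (rev X [ opposite a ]≔ x) (opposite a) ∎
      where open ≡-Reasoning
    ... | no i≢a′ = begin
      lookup (rev (X [ a ]≔ x)) i         ≡⟨ lookup-rev (X [ a ]≔ x) i ⟩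
      lookup (X [ a ]≔ x) (opposite i)    ≡⟨ lookup∘update′ (λ e → i≢a′ (trans (sym (opposite-involutive i)) (cong opposite e))) X x ⟩
      lookup X (opposite i)               ≡⟨ lookup-rev X i ⟨
      lookup (rev X) i                    ≡⟨ lookup∘update′ i≢a′ (rev X) x ⟨
      lookup (rev X [ opposite a ]≔ x) i  ∎
      where open ≡-Reasoning

  rev-swap : ∀ X a b → rev (swapSub X a b) ≡ swapSub (rev X) (opposite a) (opposite b)
  rev-swap X a b = trans (rev-update (delete X a) b inside) (cong (_[ opposite b ]≔ inside) (rev-update X a outside))

  below above : Fin v → Fin v → Bool
  below q p = toℕ q <ᵇ toℕ p
  above q p = toℕ p <ᵇ toℕ q

  below-above : Complementary below above
  below-above q p q≢p with <-cmp (toℕ q) (toℕ p)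
  ... | tri< q<p _ p≮q = cong₂ _+_ (cong ⟦_⟧ (<ᵇ-holds q<p)) (cong ⟦_⟧ (<ᵇ-fails p≮q))
  ... | tri≈ _ q≡p _ = ⊥-elim (q≢p (toℕ-injective q≡p))
  ... | tri> q≮p _ p<q = cong₂ _+_ (cong ⟦_⟧ (<ᵇ-fails q≮p)) (cong ⟦_⟧ (<ᵇ-holds p<q))

  opposite-< : ∀ {x y : Fin v} → toℕ x < toℕ y → toℕ (opposite y) < toℕ (opposite x)
  opposite-< {x} {y} x<y =
    subst₂ _<_ (sym (opposite-prop y)) (sym (opposite-prop x)) (∸-monoʳ-< (s≤s x<y) (toℕ<n y))

  below⇒above : ∀ q p → T (below q p) → T (above (opposite q) (opposite p))
  below⇒above q p h = <⇒<ᵇ (opposite-< (<ᵇ⇒< (toℕ q) (toℕ p) h))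

  above⇒below : ∀ q p → T (above q p) → T (below (opposite q) (opposite p))
  above⇒below q p h = <⇒<ᵇ (opposite-< (<ᵇ⇒< (toℕ p) (toℕ q) h))

  edge-rev : ∀ P Q → edgeᵇ (rev P) (rev Q) ≡ edgeWith above P Q
  edge-rev P Q = T-ext to from
    where
    to : T (edgeᵇ (rev P) (rev Q)) → T (edgeWith above P Q)
    to h with edgeWith-sound below (rev P) (rev Q) h
    ... | p , q , q-below-p , p∈revP , q∉revP , revQ≡ =
      edgeWith-complete above P Q (opposite p)
        (opposite q , below⇒above q p q-below-p ,
         trans (sym (lookup-rev P p)) p∈revP , trans (sym (lookup-rev P q)) q∉revP ,
         rev-injective (trans revQ≡ (sym (trans (rev-swap P (opposite p) (opposite q))
                                                (cong₂ (swapSub (rev P)) (opposite-involutive p) (opposite-involutive q))))))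
    from : T (edgeWith above P Q) → T (edgeᵇ (rev P) (rev Q))
    from h with edgeWith-sound above P Q h
    ... | p , q , q-above-p , p∈P , q∉P , Q≡ =
      edgeWith-complete below (rev P) (rev Q) (opposite p)
        (opposite q , above⇒below q p q-above-p ,
         trans (lookup-rev P (opposite p)) (trans (cong (lookup P) (opposite-involutive p)) p∈P) ,
         trans (lookup-rev P (opposite q)) (trans (cong (lookup P) (opposite-involutive q)) q∉P) ,
         trans (cong rev Q≡) (rev-swap P p q))

  outdegree-reversal : ∀ {t} {g : Fam v} → SteinerBlocks t g → (P : Subset v) → ∣ P ∣ ≡ suc t → g P ≡ false →
                       outBlocks (suc t) g P + outBlocks (suc t) (act g ρ) (rev P) ≡ suc t
  outdegree-reversal {t} {g} G P |P|≡k P∉g = begin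
    outBlocks (suc t) g P + outBlocks (suc t) (act g ρ) (rev P)
      ≡⟨ cong (_+_ (outBlocks (suc t) g P)) upward ⟩
    outBlocks (suc t) g P + count (λ Q → edgeWith above P Q ∧ g Q) K
      ≡⟨ OutDegree.outdegree-complementary G P |P|≡k P∉g below above below-above ⟩
    suc t ∎
    where
    open ≡-Reasoning
    K : List (Subset v)
    K = kSubsets v (suc t)
    upward : outBlocks (suc t) (act g ρ) (rev P) ≡ count (λ Q → edgeWith above P Q ∧ g Q) K
    upward = begin
      count (λ Q → edgeᵇ (rev P) Q ∧ g (rev Q)) K
        ≡⟨ count-kSubsets-relabel (suc t) ρ ρ-permutation (λ Q → edgeᵇ (rev P) Q ∧ g (rev Q)) ⟨
      count (λ Q → edgeᵇ (rev P) (rev Q) ∧ g (rev (rev Q))) K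
        ≡⟨ count-cong _ _ K (λ Q _ → cong₂ _∧_ (edge-rev P Q) (cong g (rev-involutive Q))) ⟩
      count (λ Q → edgeWith above P Q ∧ g Q) K ∎

sum-≡ᵇ : ∀ x y {k} → x + y ≡ k → (y ≡ᵇ 0) ≡ (x ≡ᵇ k)
sum-≡ᵇ x y {k} x+y≡k = T-ext
  (λ h → ≡⇒≡ᵇ x k (trans (sym (trans (cong (_+_ x) (≡ᵇ⇒≡ y 0 h)) (+-identityʳ x))) x+y≡k))
  (λ h → ≡⇒≡ᵇ y 0 (+-cancelˡ-≡ x y 0 (trans x+y≡k (trans (sym (≡ᵇ⇒≡ x k h)) (sym (+-identityʳ x))))))

module Coefficients (t v : ℕ) where
  open Reversal v

  private
    k : ℕ
    k = suc t
    K : List (Subset v)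
    K = kSubsets v k

  a₀ aₖ : Fam v → ℕ
  a₀ g = aCoef k g 0
  aₖ g = aCoef k g k

  aCoef-reversed : ∀ g i → aCoef k (act g ρ) i ≡ count (λ P → not (g P) ∧ (outBlocks k (act g ρ) (rev P) ≡ᵇ i)) K
  aCoef-reversed g i = begin
    count (λ P → not (g (rev P)) ∧ (outBlocks k (act g ρ) P ≡ᵇ i)) K
      ≡⟨ count-kSubsets-relabel k ρ ρ-permutation (λ P → not (g (rev P)) ∧ (outBlocks k (act g ρ) P ≡ᵇ i)) ⟨
    count (λ P → not (g (rev (rev P))) ∧ (outBlocks k (act g ρ) (rev P) ≡ᵇ i)) K
      ≡⟨ count-cong _ _ K (λ P _ → cong (λ X → not (g X) ∧ (outBlocks k (act g ρ) (rev P) ≡ᵇ i)) (rev-involutive P)) ⟩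
    count (λ P → not (g P) ∧ (outBlocks k (act g ρ) (rev P) ≡ᵇ i)) K ∎
    where open ≡-Reasoning

  -- Since the out-degrees of P in g and of ρ P in g^ρ add up to k,
  -- the non-blocks of out-degree i in g^ρ are those of out-degree k - i in g.
  aCoef-reversed-exchange : ∀ {g} → SteinerBlocks t g → ∀ i j → (∀ x y → x + y ≡ k → (y ≡ᵇ i) ≡ (x ≡ᵇ j)) →
                            aCoef k (act g ρ) i ≡ aCoef k g j
  aCoef-reversed-exchange {g} G i j exchange = trans (aCoef-reversed g i) (count-cong _ _ K same)
    where
    same : ∀ P → P ∈ K → (not (g P) ∧ (outBlocks k (act g ρ) (rev P) ≡ᵇ i)) ≡ (not (g P) ∧ (outBlocks k g P ≡ᵇ j))
    same P m with g P in P∉g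
    ... | true  = refl
    ... | false = exchange (outBlocks k g P) (outBlocks k (act g ρ) (rev P)) (outdegree-reversal G P (∈-kSubsets⁻ k P m) P∉g)

  a₀-reversed : ∀ {g} → SteinerBlocks t g → a₀ (act g ρ) ≡ aₖ g
  a₀-reversed G = aCoef-reversed-exchange G 0 k (λ x y → sum-≡ᵇ x y)

  aₖ-reversed : ∀ {g} → SteinerBlocks t g → aₖ (act g ρ) ≡ a₀ g
  aₖ-reversed G = aCoef-reversed-exchange G k 0 (λ x y x+y≡k → sym (sum-≡ᵇ y x (trans (+-comm y x) x+y≡k)))

  -- P̃(g) consists of the non-blocks with no block among their out-neighbours.
  Ptilde≡a₀ : ∀ g → Ptilde k g ≡ a₀ g
  Ptilde≡a₀ g = count-cong _ _ K same
    where
    same : ∀ P → P ∈ K → not (inPbarᵇ k g P) ≡ (not (g P) ∧ (outBlocks k g P ≡ᵇ 0))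
    same P _ with g P
    ... | true  = refl
    ... | false = trans (cong not (any-cong (λ B → ∧-comm (g B) (edgeᵇ P B)) K))
                        (sym (count≡0 (λ Q → edgeᵇ P Q ∧ g Q) K))
      where
      any-cong : {A : Set} {p q : A → Bool} → (∀ x → p x ≡ q x) → ∀ xs → any p xs ≡ any q xs
      any-cong h []       = refl
      any-cong h (x ∷ xs) = cong₂ _∨_ (h x) (any-cong h xs)

  Pbar+a₀ : ∀ g → Pbar k g + a₀ g ≡ length K
  Pbar+a₀ g = trans (cong (_+_ (Pbar k g)) (sym (Ptilde≡a₀ g))) (count-complement (inPbarᵇ k g) K)

  aCoef-cong : ∀ {f g} → (∀ Q → f Q ≡ g Q) → ∀ i → aCoef k f i ≡ aCoef k g i
  aCoef-cong {f} {g} f≗g i = count-cong _ _ K λ P _ →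
    cong₂ (λ b n → not b ∧ (n ≡ᵇ i)) (f≗g P) (count-cong _ _ K (λ Q _ → cong (edgeᵇ P Q ∧_) (f≗g Q)))

-- The orbit O(D) and its symmetry under reversal

module Orbit (t v : ℕ) (D : Fam v) (G : SteinerBlocks t D) where
  open Reversal v
  open Coefficients t v

  _≈_ : Fam v → Fam v → Set
  f ≈ g = T (sameFam f g)

  ≈⇒≗ : ∀ {f g} → f ≈ g → ∀ Q → f Q ≡ g Q
  ≈⇒≗ {f} {g} h Q = toWitness (All.lookup (AllP.all⁺ (λ Q → ⌊ f Q ≟B g Q ⌋) (allSubsets v) h) (allSubsets-complete Q))

  ≗⇒≈ : ∀ {f g} → (∀ Q → f Q ≡ g Q) → f ≈ g
  ≗⇒≈ {f} {g} h = AllP.all⁻ (λ Q → ⌊ f Q ≟B g Q ⌋) {xs = allSubsets v} (All.tabulate (λ {Q} _ → fromWitness (h Q)))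

  O : List (Fam v)
  O = orbit D

  O-distinct : AllPairs (λ f g → ¬ f ≈ g) O
  O-distinct = deduplicated (map (act D) (perms v))
    where
    deduplicated : ∀ xs → AllPairs (λ f g → ¬ f ≈ g) (deduplicateᵇ sameFam xs)
    deduplicated []       = []
    deduplicated (x ∷ xs) = AllP.all-filter (¬? ∘ T? ∘ sameFam x) (deduplicateᵇ sameFam xs)
                          ∷ AllPairsP.filter⁺ _ (deduplicated xs)

  O-member : ∀ {g} → g ∈ O → Σ (Vec (Fin v) v) λ s → IsPermutation s × g ≡ act D s
  O-member m with ∈-map⁻ (act D) (AnyP.deduplicate⁻ _ m)
  ... | s , s∈perms , refl = s , injectiveᵇ-sound s (proj₂ (∈-filter⁻ (T? ∘ injectiveᵇ) {xs = allVecs (allFin v) v} s∈perms)) , refl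

  O-steiner : ∀ {g} → g ∈ O → SteinerBlocks t g
  O-steiner m with O-member m
  ... | s , perm , refl = relabel-blocks D s perm G

  O-reversed : ∀ {g} → g ∈ O → Any (act g ρ ≈_) O
  O-reversed m with O-member m
  ... | s , perm , refl =
    AnyP.deduplicate⁺ _ respects (lose (∈-map⁺ (act D) s′∈perms) (≗⇒≈ reversed≗))
    where
    s′ : Vec (Fin v) v
    s′ = tabulate (λ j → lookup ρ (lookup s j))
    lookup-s′ : ∀ j → lookup s′ j ≡ lookup ρ (lookup s j)
    lookup-s′ = lookup∘tabulate _
    s′∈perms : s′ ∈ perms v
    s′∈perms = ∈-filter⁺ (T? ∘ injectiveᵇ) (allVecs-complete (allFin v) ∈-allFin s′)
                 (injectiveᵇ-complete s′ (λ {x} {y} e → perm (ρ-permutation (trans (sym (lookup-s′ x)) (trans e (lookup-s′ y))))))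
    reversed≗ : ∀ Q → act (act D s) ρ Q ≡ act D s′ Q
    reversed≗ Q = cong D (tabulate-cong (λ i → trans (lookup-relabel ρ Q (lookup s i)) (cong (lookup Q) (sym (lookup-s′ i)))))
    respects : ∀ {f f′} → T (sameFam f′ f) → act (act D s) ρ ≈ f → act (act D s) ρ ≈ f′
    respects f′≈f h = ≗⇒≈ (λ Q → trans (≈⇒≗ h Q) (sym (≈⇒≗ f′≈f Q)))

  -- Reversal maps the designs with a₀ = x, aₖ = y injectively to those with a₀ = y, aₖ = x.
  exchange-≤ : (χ : ℕ → ℕ → Bool) → count (λ g → χ (a₀ g) (aₖ g)) O ≤ count (λ g → χ (aₖ g) (a₀ g)) O
  exchange-≤ χ = pigeonhole _≈_ (λ g h → act g ρ ≈ h) (filterᵇ before O) (filterᵇ after O)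
                   (AllPairsP.filter⁺ _ O-distinct) covered functional
    where
    before after : Fam v → Bool
    before g = χ (a₀ g) (aₖ g)
    after g = χ (aₖ g) (a₀ g)
    covered : ∀ g → g ∈ filterᵇ before O → Any (λ h → act g ρ ≈ h) (filterᵇ after O)
    covered g m with ∈-filter⁻ (T? ∘ before) {xs = O} m
    ... | g∈O , χ-holds with find (O-reversed g∈O)
    ... | h , h∈O , gρ≈h = lose (∈-filter⁺ (T? ∘ after) h∈O (subst T same χ-holds)) gρ≈h
      where
      G′ : SteinerBlocks t g
      G′ = O-steiner g∈O
      same : χ (a₀ g) (aₖ g) ≡ χ (aₖ h) (a₀ h)
      same = cong₂ χ (trans (sym (aₖ-reversed G′)) (aCoef-cong (≈⇒≗ gρ≈h) (suc t)))
                     (trans (sym (a₀-reversed G′)) (aCoef-cong (≈⇒≗ gρ≈h) 0))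
    functional : ∀ g g′ h → g ∈ _ → g′ ∈ _ → act g ρ ≈ h → act g′ ρ ≈ h → g ≈ g′
    functional g g′ h _ _ gρ≈h g′ρ≈h = ≗⇒≈ λ Q → begin
      g Q                    ≡⟨ cong g (rev-involutive Q) ⟨
      g (rev (rev Q))        ≡⟨ ≈⇒≗ gρ≈h (rev Q) ⟩
      h (rev Q)              ≡⟨ ≈⇒≗ g′ρ≈h (rev Q) ⟨
      g′ (rev (rev Q))       ≡⟨ cong g′ (rev-involutive Q) ⟩
      g′ Q                   ∎
      where open ≡-Reasoning

  exchange : (χ : ℕ → ℕ → Bool) → count (λ g → χ (a₀ g) (aₖ g)) O ≡ count (λ g → χ (aₖ g) (a₀ g)) O
  exchange χ = ≤-antisym (exchange-≤ χ) (exchange-≤ (λ x y → χ y x))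

≟-opposite : ∀ x y x′ y′ → x - y ≡ ℤ.- (x′ - y′) → ⌊ x ≟ℤ y ⌋ ≡ ⌊ x′ ≟ℤ y′ ⌋
≟-opposite x y x′ y′ opposite = T-ext
  (λ x≡y → fromWitness (i-j≡0⇒i≡j x′ y′ (begin
    x′ - y′              ≡⟨ neg-involutive (x′ - y′) ⟨
    ℤ.- ℤ.- (x′ - y′)    ≡⟨ cong ℤ.-_ opposite ⟨
    ℤ.- (x - y)          ≡⟨ cong ℤ.-_ (i≡j⇒i-j≡0 (toWitness x≡y)) ⟩
    + 0                  ∎)))
  (λ x′≡y′ → fromWitness (i-j≡0⇒i≡j x y (trans opposite (cong ℤ.-_ (i≡j⇒i-j≡0 (toWitness x′≡y′))))))
  where open ≡-Reasoning

≡ᵇ-as-≟ℤ : ∀ m n → (m ≡ᵇ n) ≡ ⌊ + m ≟ℤ + n ⌋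
≡ᵇ-as-≟ℤ m n = T-ext (λ h → fromWitness (cong +_ (≡ᵇ⇒≡ m n h)))
                     (λ h → ≡⇒≡ᵇ m n (cong ℤ.∣_∣ (toWitness h)))

reflection-identity : ∀ (a b c : ℤ) → b - c ≡ ℤ.- (a - ((a ℤ.+ b) - c))
reflection-identity = solve-∀

reflection-identity′ : ∀ (C a b c : ℤ) → (C - b) - c ≡ ℤ.- ((C - a) - ((C ℤ.+ C) - (a ℤ.+ b) - c))
reflection-identity′ = solve-∀

difference-identity : ∀ (a b : ℤ) → a ≡ (a ℤ.+ b) - b
difference-identity = solve-∀

module Symmetry (t v : ℕ) (D : Fam v) (G : SteinerBlocks t D) (α : ℕ) where
  open Coefficients t v
  open Orbit t v D G

  private
    k : ℕ
    k = suc t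
    #K : ℕ
    #K = length (kSubsets v k)

  Nα : (ℕ → ℕ → Bool) → ℕ
  Nα ψ = count (λ g → (a0ak k g ≡ᵇ α) ∧ ψ (a₀ g) (aₖ g)) O

  Nα-exchange : ∀ ψ → Nα ψ ≡ Nα (λ x y → ψ y x)
  Nα-exchange ψ = trans (exchange (λ x y → (x + y ≡ᵇ α) ∧ ψ x y))
    (count-cong _ _ O (λ g _ → cong (λ m → (m ≡ᵇ α) ∧ ψ (aₖ g) (a₀ g)) (+-comm (aₖ g) (a₀ g))))

  Nα-cong : ∀ ψ ψ′ → (∀ x y → x + y ≡ α → ψ x y ≡ ψ′ x y) → Nα ψ ≡ Nα ψ′
  Nα-cong ψ ψ′ same = count-cong _ _ O λ g _ → conditional (λ c → same _ _ (≡ᵇ⇒≡ _ α c))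
    where
    conditional : ∀ {c a b} → (T c → a ≡ b) → (c ∧ a) ≡ (c ∧ b)
    conditional {false} h = refl
    conditional {true}  h = h _

  withSize : (Fam v → ℕ) → ℤ → ℕ
  withSize size z = count (λ g → (a0ak k g ≡ᵇ α) ∧ ⌊ + size g ≟ℤ z ⌋) O

  withSize-+ : ∀ size n → count (λ g → (a0ak k g ≡ᵇ α) ∧ (size g ≡ᵇ n)) O ≡ withSize size (+ n)
  withSize-+ size n = count-cong _ _ O λ g _ → cong ((a0ak k g ≡ᵇ α) ∧_) (≡ᵇ-as-≟ℤ (size g) n)

  withSize-negative : ∀ size n → withSize size -[1+ n ] ≡ 0
  withSize-negative size n = count-none _ O λ g _ → ∧-zeroʳ _

  -- |P̃| = a₀ and |P̄| = #K - a₀, so F̃ and F only see the coefficient a₀.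
  Ftilde-by-a₀ : ∀ z → Ftilde k D z α ≡ Nα (λ x _ → ⌊ + x ≟ℤ z ⌋)
  Ftilde-by-a₀ z = trans (by-size z) (count-cong _ _ O λ g _ →
                     cong (λ m → (a0ak k g ≡ᵇ α) ∧ ⌊ + m ≟ℤ z ⌋) (Ptilde≡a₀ g))
    where
    by-size : ∀ z → Ftilde k D z α ≡ withSize (Ptilde k) z
    by-size (+ n)      = withSize-+ (Ptilde k) n
    by-size -[1+ n ]   = sym (withSize-negative (Ptilde k) n)

  F-by-a₀ : ∀ z → F k D z α ≡ Nα (λ x _ → ⌊ + #K - + x ≟ℤ z ⌋)
  F-by-a₀ z = trans (by-size z) (count-cong _ _ O λ g _ →
                cong (λ m → (a0ak k g ≡ᵇ α) ∧ ⌊ m ≟ℤ z ⌋) (Pbar-as-difference g))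
    where
    by-size : ∀ z → F k D z α ≡ withSize (Pbar k) z
    by-size (+ n)      = withSize-+ (Pbar k) n
    by-size -[1+ n ]   = sym (withSize-negative (Pbar k) n)
    Pbar-as-difference : ∀ g → + Pbar k g ≡ + #K - + a₀ g
    Pbar-as-difference g = trans (difference-identity (+ Pbar k g) (+ a₀ g))
                                 (cong (λ m → m - + a₀ g) (trans (sym (pos-+ (Pbar k g) (a₀ g))) (cong +_ (Pbar+a₀ g))))

  Ftilde-reflection : ∀ n → Ftilde k D (+ n) α ≡ Ftilde k D (+ α - + n) α
  Ftilde-reflection n = begin
    Ftilde k D (+ n) α                          ≡⟨ Ftilde-by-a₀ (+ n) ⟩
    Nα (λ x _ → ⌊ + x ≟ℤ + n ⌋)                 ≡⟨ Nα-exchange (λ x _ → ⌊ + x ≟ℤ + n ⌋) ⟩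
    Nα (λ _ y → ⌊ + y ≟ℤ + n ⌋)                 ≡⟨ Nα-cong _ _ reflect ⟩
    Nα (λ x _ → ⌊ + x ≟ℤ + α - + n ⌋)           ≡⟨ Ftilde-by-a₀ (+ α - + n) ⟨
    Ftilde k D (+ α - + n) α                    ∎
    where
    open ≡-Reasoning
    reflect : ∀ x y → x + y ≡ α → ⌊ + y ≟ℤ + n ⌋ ≡ ⌊ + x ≟ℤ + α - + n ⌋
    reflect x y x+y≡α = ≟-opposite _ _ _ _ (begin
      + y - + n                                    ≡⟨ reflection-identity (+ x) (+ y) (+ n) ⟩
      ℤ.- (+ x - ((+ x ℤ.+ + y) - + n))            ≡⟨ cong (λ a → ℤ.- (+ x - (a - + n))) (trans (sym (pos-+ x y)) (cong +_ x+y≡α)) ⟩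
      ℤ.- (+ x - (+ α - + n))                      ∎)

  F-reflection : ∀ n → F k D (+ n) α ≡ F k D (+ (2 * #K) - + α - + n) α
  F-reflection n = begin
    F k D (+ n) α                                  ≡⟨ F-by-a₀ (+ n) ⟩
    Nα (λ x _ → ⌊ + #K - + x ≟ℤ + n ⌋)              ≡⟨ Nα-exchange (λ x _ → ⌊ + #K - + x ≟ℤ + n ⌋) ⟩
    Nα (λ _ y → ⌊ + #K - + y ≟ℤ + n ⌋)              ≡⟨ Nα-cong _ _ reflect ⟩
    Nα (λ x _ → ⌊ + #K - + x ≟ℤ + (2 * #K) - + α - + n ⌋) ≡⟨ F-by-a₀ (+ (2 * #K) - + α - + n) ⟨
    F k D (+ (2 * #K) - + α - + n) α                ∎
    where
    open ≡-Reasoning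
    twice : + (2 * #K) ≡ + #K ℤ.+ + #K
    twice = trans (cong (λ m → + (#K + m)) (+-identityʳ #K)) (pos-+ #K #K)
    reflect : ∀ x y → x + y ≡ α → ⌊ + #K - + y ≟ℤ + n ⌋ ≡ ⌊ + #K - + x ≟ℤ + (2 * #K) - + α - + n ⌋
    reflect x y x+y≡α = ≟-opposite _ _ _ _ (begin
      (+ #K - + y) - + n                                          ≡⟨ reflection-identity′ (+ #K) (+ x) (+ y) (+ n) ⟩
      ℤ.- ((+ #K - + x) - ((+ #K ℤ.+ + #K) - (+ x ℤ.+ + y) - + n))  ≡⟨ cong₂ (λ a b → ℤ.- ((+ #K - + x) - (a - b - + n))) (sym twice)
                                                                          (trans (sym (pos-+ x y)) (cong +_ x+y≡α)) ⟩
      ℤ.- ((+ #K - + x) - (+ (2 * #K) - + α - + n))                ∎)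

-- Proposition 5.1.
proposition5p1 : (t v : ℕ) → suc t ≤ v → (D : Fam v) → Steiner t (suc t) v D →
    (α : ℕ) → α ∈ sSet (suc t) D → (n : ℕ) →
    (Ftilde (suc t) D (+ n) α ≡ Ftilde (suc t) D (+ α - + n) α)
    × (F (suc t) D (+ n) α ≡ F (suc t) D (+ (2 * (v C suc t)) - + α - + n) α)
proposition5p1 t v _ D steiner α _ n =
  Ftilde-reflection n ,
  trans (F-reflection n) (cong (λ c → F (suc t) D (+ (2 * c) - + α - + n) α) (number-of-kSubsets v (suc t)))
  where open Symmetry t v D (steiner⇒blocks D steiner) α
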